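{- Let $G_1$ and $G_2$ be vertex-disjoint connected graphs that are not isomorphic, and let $G$ be their disjoint union. Let $\mathcal{G}$, $\mathcal{G}_1$, $\mathcal{G}_2$ be the unlabeled graphs containing $G$, $G_1$, $G_2$, respectively. Then for every $k\in\mathbb{N}$, $P_{\ell}(\mathcal{G},k) = P_{\ell}(\mathcal{G}_1,k)\,P_{\ell}(\mathcal{G}_2,k)$.
   Context: All graphs are finite and simple. An unlabeled graph is an isomorphism class of graphs. A $k$-assignment $L$ for a graph $H$ assigns to each vertex $v$ a set $L(v)$ of $k$ colors; a proper $L$-coloring is a proper coloring $f$ with $f(v)\in L(v)$ for all $v$. For $H$ in an unlabeled graph $\mathcal{H}$ and a $k$-assignment $L$ of $H$, two proper $L$-colorings $f,g$ of $H$ are equivalent if $f\pi = g$ for some $\pi\in\mathrm{Aut}(H)$; $u_\ell(H,L)$ is the number of equivalence classes. The unlabeled list color function $P_\ell(\mathcal{H},k)$ is the minimum of $u_\ell(H,L)$ over all $k$-assignments $L$ of $H$, for an arbitrarily chosen $H\in\mathcal{H}$. -}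

module Defs where

open import Data.Nat using (ℕ; _+_; _*_; _≤_; _≥_)
open import Data.Fin using (Fin; splitAt)
open import Data.Bool using (Bool; true; false)
open import Data.Sum using (_⊎_; inj₁; inj₂)
open import Data.Product using (Σ; ∃; _×_; _,_)
open import Data.List using (List; length)
open import Data.List.Membership.Propositional using (_∈_)
open import Data.List.Relation.Unary.All using (All)
open import Data.List.Relation.Unary.Any using (Any)
open import Data.List.Relation.Unary.AllPairs using (AllPairs)
open import Data.List.Relation.Unary.Unique.Propositional using (Unique)
open import Function.Bundles using (_↔_; Inverse)
open import Relation.Binary.PropositionalEquality using (_≡_; _≢_)
open import Relation.Nullary using (¬_)

record Graph (n : ℕ) : Set where
  field
    adj   : Fin n → Fin n → Bool
    sym   : ∀ u v → adj u v ≡ adj v u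
    irrefl : ∀ v → adj v v ≡ false
open Graph public

Adj : ∀ {n} → Graph n → Fin n → Fin n → Set
Adj G u v = adj G u v ≡ true

Isomorphic : ∀ {n m} → Graph n → Graph m → Set
Isomorphic {n} {m} G H =
  Σ (Fin n ↔ Fin m) λ φ → ∀ u v → adj H (Inverse.to φ u) (Inverse.to φ v) ≡ adj G u v

Aut : ∀ {n} → Graph n → Set
Aut {n} G = Σ (Fin n ↔ Fin n) λ π → ∀ u v → adj G (Inverse.to π u) (Inverse.to π v) ≡ adj G u v

data Reach {n} (G : Graph n) : Fin n → Fin n → Set where
  here : ∀ {v} → Reach G v v
  step : ∀ {u w v} → Adj G u w → Reach G w v → Reach G u v

Connected : ∀ {n} → Graph n → Set
Connected {n} G = (1 ≤ n) × (∀ u v → Reach G u v)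

-- Disjoint union: vertices Fin n₁ come first, then Fin n₂
unionAdj : ∀ {n₁ n₂} → Graph n₁ → Graph n₂ → Fin (n₁ + n₂) → Fin (n₁ + n₂) → Bool
unionAdj {n₁} G₁ G₂ u v with splitAt n₁ u | splitAt n₁ v
... | inj₁ a | inj₁ b = adj G₁ a b
... | inj₂ a | inj₂ b = adj G₂ a b
... | inj₁ _ | inj₂ _ = false
... | inj₂ _ | inj₁ _ = false

unionSym : ∀ {n₁ n₂} (G₁ : Graph n₁) (G₂ : Graph n₂) u v →
           unionAdj G₁ G₂ u v ≡ unionAdj G₁ G₂ v u
unionSym {n₁} G₁ G₂ u v with splitAt n₁ u | splitAt n₁ v
... | inj₁ a | inj₁ b = sym G₁ a b
... | inj₂ a | inj₂ b = sym G₂ a b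
... | inj₁ _ | inj₂ _ = _≡_.refl
... | inj₂ _ | inj₁ _ = _≡_.refl

unionIrrefl : ∀ {n₁ n₂} (G₁ : Graph n₁) (G₂ : Graph n₂) v → unionAdj G₁ G₂ v v ≡ false
unionIrrefl {n₁} G₁ G₂ v with splitAt n₁ v
... | inj₁ a = irrefl G₁ a
... | inj₂ a = irrefl G₂ a

_⊕_ : ∀ {n₁ n₂} → Graph n₁ → Graph n₂ → Graph (n₁ + n₂)
G₁ ⊕ G₂ = record { adj = unionAdj G₁ G₂ ; sym = unionSym G₁ G₂ ; irrefl = unionIrrefl G₁ G₂ }

-- Colors are natural numbers.  A k-assignment gives each vertex a list of
-- k distinct colors (i.e. a k-element set of colors).
KAssignment : ∀ {n} → Graph n → ℕ → (Fin n → List ℕ) → Set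
KAssignment {n} G k L = ∀ v → Unique (L v) × (length (L v) ≡ k)

ProperLColoring : ∀ {n} → Graph n → (Fin n → List ℕ) → (Fin n → ℕ) → Set
ProperLColoring {n} G L f = (∀ v → f v ∈ L v) × (∀ u v → Adj G u v → f u ≢ f v)

Equivalent : ∀ {n} → Graph n → (Fin n → ℕ) → (Fin n → ℕ) → Set
Equivalent G f g = Σ (Aut G) λ π → ∀ v → f (Inverse.to (Data.Product.proj₁ π) v) ≡ g v

-- u_ℓ(G,L) = m : there is a list of m pairwise inequivalent proper
-- L-colorings such that every proper L-coloring is equivalent to one of them
-- (a complete system of representatives of the equivalence classes).
UnlabeledCount : ∀ {n} → Graph n → (Fin n → List ℕ) → ℕ → Set
UnlabeledCount {n} G L m =
  Σ (List (Fin n → ℕ)) λ reps →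
    (length reps ≡ m)
    × All (ProperLColoring G L) reps
    × AllPairs (λ f g → ¬ Equivalent G f g) reps
    × (∀ f → ProperLColoring G L f → Any (λ g → Equivalent G f g) reps)

-- P_ℓ(G,k) = m : m is the minimum of u_ℓ(G,L) over all k-assignments L
UnlabeledListColorFn : ∀ {n} → Graph n → ℕ → ℕ → Set
UnlabeledListColorFn {n} G k m =
  (Σ (Fin n → List ℕ) λ L → KAssignment G k L × UnlabeledCount G L m)
  × (∀ L m′ → KAssignment G k L → UnlabeledCount G L m′ → m ≤ m′)

{-# OPTIONS --safe #-}
-- G₁ and G₂ are the connected components of G₁ ⊕ G₂, so an automorphism maps each of them onto one
-- side; as G₁ ≇ G₂ it cannot exchange them, hence Aut (G₁ ⊕ G₂) = Aut G₁ × Aut G₂.  Two colorings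
-- of G₁ ⊕ G₂ are therefore equivalent iff their restrictions to G₁ and to G₂ are, and for every
-- list assignment L the products g₁ ++ g₂ of representatives for L restricted to G₁ and to G₂ form
-- a complete system of representatives for L.  So u_ℓ(G₁ ⊕ G₂, L) = u_ℓ(G₁, L|G₁) · u_ℓ(G₂, L|G₂),
-- and since the k-assignments of G₁ ⊕ G₂ are exactly the pairs of k-assignments, the minima multiply.
-- That u_ℓ(H, L) exists at all (and is unique) comes from a finite search: L-colorings and
-- automorphisms can be enumerated and equivalence is decidable.
module Submission where

open import Defs hiding (sym)
open import Level using (0ℓ)
open import Data.Bool using (Bool; true; false; not)
import Data.Bool.Properties as Bool
open import Data.Empty using (⊥-elim)
open import Data.Fin using (Fin; zero; suc; _↑ˡ_; _↑ʳ_; splitAt; fromℕ<)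
import Data.Fin.Properties as Fin
open import Data.Nat using (ℕ; _+_; _*_; _≤_)
import Data.Nat.Properties as ℕ
open import Data.Product using (Σ; ∃; _×_; _,_; proj₁; proj₂; map₁)
open import Data.Sum using (inj₁; inj₂)
open import Data.List using (List; []; _∷_; map; [_]; length; lookup; filter; deduplicate; cartesianProductWith)
import Data.List.Properties as List
open import Data.List.Membership.Propositional using (_∈_)
open import Data.List.Membership.DecPropositional ℕ._≟_ using (_∈?_)
import Data.List.Membership.Propositional.Properties as ∈
import Data.List.Membership.Setoid as SetoidMembership
import Data.List.Membership.Setoid.Properties as SetoidMembershipₚ
open import Data.List.Relation.Unary.All as All using (All)
import Data.List.Relation.Unary.All.Properties as All
open import Data.List.Relation.Unary.Any as Any using (Any; here)
import Data.List.Relation.Unary.Any.Properties as Any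
open import Data.List.Relation.Unary.AllPairs using (_∷_)
open import Data.List.Relation.Unary.Unique.Setoid using (Unique)
import Data.List.Relation.Unary.Unique.Setoid.Properties as Unique
import Data.List.Relation.Unary.Unique.DecSetoid.Properties as Unique
open import Data.List.Relation.Unary.Unique.Propositional using () renaming (Unique to Unique≡)
open import Data.Vec.Functional as Vector using (_++_)
import Data.Vec.Functional.Properties as Vector
open import Function using (_∘_)
open import Function.Bundles using (Inverse; _↔_; mk↔ₛ′)
open import Function.Definitions using (Injective)
open import Relation.Binary using (Setoid; DecSetoid; Decidable)
open import Relation.Binary.PropositionalEquality
  as ≡ using (_≡_; _≢_; _≗_; refl; sym; trans; cong; cong₂; subst₂; _→-setoid_; module ≡-Reasoning)
open import Relation.Nullary using (Dec; ¬_)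
open import Relation.Nullary.Decidable using (_×-dec_; _→-dec_; ¬?; map′)
open import Relation.Unary using () renaming (Decidable to Decidable₁)

private
  variable
    n m k n′ m′ : ℕ

-- Finite search and counting

true≢false : true ≢ false
true≢false ()

∃-map? : ∀ {P : (Fin n → Fin m) → Set} →
  (∀ {σ σ′} → σ ≗ σ′ → P σ → P σ′) → Decidable₁ P → Dec (∃ P)
∃-map? {n = ℕ.zero}  resp P? = map′ (λ p → _ , p) (λ (σ , p) → resp (λ ()) p) (P? (λ ()))
∃-map? {n = ℕ.suc n} resp P? =
  map′ (λ (i , σ , p) → i Vector.∷ σ , p)
       (λ (σ , p) → Vector.head σ , Vector.tail σ , resp (λ { zero → refl ; (suc j) → refl }) p)
       (Fin.any? λ i → ∃-map? (λ σ≗σ′ → resp λ { zero → refl ; (suc j) → σ≗σ′ j }) (P? ∘ (i Vector.∷_)))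

choiceFunctions : ∀ {A : Set} → (Fin n → List A) → List (Fin n → A)
choiceFunctions {n = ℕ.zero}  L = [ Vector.[] ]
choiceFunctions {n = ℕ.suc n} L = cartesianProductWith Vector._∷_ (Vector.head L) (choiceFunctions (Vector.tail L))

choiceFunctions-complete : ∀ {A : Set} {L : Fin n → List A} {f} → (∀ v → f v ∈ L v) → Any (f ≗_) (choiceFunctions L)
choiceFunctions-complete {n = ℕ.zero}  f∈L = here (λ ())
choiceFunctions-complete {n = ℕ.suc n} f∈L =
  Any.cartesianProductWith⁺ Vector._∷_ (λ f₀≡x f′≗xs → λ { zero → f₀≡x ; (suc v) → f′≗xs v })
    (f∈L zero) (choiceFunctions-complete (f∈L ∘ suc))

length-cartesianProductWith : ∀ {A B C : Set} (f : A → B → C) xs ys →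
  length (cartesianProductWith f xs ys) ≡ length xs * length ys
length-cartesianProductWith f []       ys = refl
length-cartesianProductWith f (x ∷ xs) ys =
  trans (List.length-++ (map (f x) ys)) (cong₂ _+_ (List.length-map (f x) ys) (length-cartesianProductWith f xs ys))

module _ {a ℓ} (S : Setoid a ℓ) where

  open Setoid S using (_≈_) renaming (sym to ≈-sym)
  open SetoidMembership S using () renaming (_∈_ to _∈ₛ_)

  Unique-lookup-injective : ∀ {xs} → Unique S xs → ∀ {i j} → lookup xs i ≈ lookup xs j → i ≡ j
  Unique-lookup-injective (x≉xs ∷ _) {zero}  {zero}  _   = refl
  Unique-lookup-injective (x≉xs ∷ _) {zero}  {suc j} x≈y = ⊥-elim (All.lookup x≉xs (∈.∈-lookup j) x≈y)
  Unique-lookup-injective (x≉xs ∷ _) {suc i} {zero}  y≈x = ⊥-elim (All.lookup x≉xs (∈.∈-lookup i) (≈-sym y≈x))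
  Unique-lookup-injective (_ ∷ xs!)  {suc i} {suc j} x≈y = cong suc (Unique-lookup-injective xs! x≈y)

  -- Sending position i of xs to the position in ys of an element equivalent to lookup xs i is injective.
  Unique⇒length≤ : ∀ {xs ys} → Unique S xs → All (_∈ₛ ys) xs → length xs ≤ length ys
  Unique⇒length≤ {xs} xs! xs⊆ys = Fin.injective⇒≤ λ {i} {j} same →
    Unique-lookup-injective xs! (SetoidMembershipₚ.index-injective S (position i) (position j) same)
    where
    position : ∀ i → lookup xs i ∈ₛ _
    position i = All.lookup xs⊆ys (∈.∈-lookup i)

-- Isomorphisms

-- Generic in P because the graphs cannot be inferred from an unfolded Isomorphic G H.
module _ {P : Fin n ↔ Fin m → Set} (φ : Σ (Fin n ↔ Fin m) P) where

  to : Fin n → Fin m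
  to = Inverse.to (proj₁ φ)

  from : Fin m → Fin n
  from = Inverse.from (proj₁ φ)

  to-from : ∀ y → to (from y) ≡ y
  to-from = Inverse.strictlyInverseˡ (proj₁ φ)

  from-to : ∀ x → from (to x) ≡ x
  from-to = Inverse.strictlyInverseʳ (proj₁ φ)

IsIsomorphism : Graph n → Graph m → (Fin n → Fin m) → (Fin m → Fin n) → Set
IsIsomorphism G H σ τ =
  (∀ y → σ (τ y) ≡ y) × (∀ x → τ (σ x) ≡ x) × (∀ u v → adj H (σ u) (σ v) ≡ adj G u v)

isomorphism : ∀ (G : Graph n) (H : Graph m) σ τ → IsIsomorphism G H σ τ → Isomorphic G H
isomorphism G H σ τ (στ , τσ , adj-σ) = mk↔ₛ′ σ τ στ τσ , adj-σ

IsIsomorphism? : ∀ (G : Graph n) (H : Graph m) σ τ → Dec (IsIsomorphism G H σ τ)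
IsIsomorphism? G H σ τ = Fin.all? (λ y → σ (τ y) Fin.≟ y) ×-dec Fin.all? (λ x → τ (σ x) Fin.≟ x)
  ×-dec Fin.all? (λ u → Fin.all? λ v → adj H (σ u) (σ v) Bool.≟ adj G u v)

module _ {G : Graph n} {H : Graph m} {σ : Fin n → Fin m} {τ : Fin m → Fin n} where

  IsIsomorphism-respˡ : ∀ {σ′} → σ ≗ σ′ → IsIsomorphism G H σ τ → IsIsomorphism G H σ′ τ
  IsIsomorphism-respˡ σ≗σ′ (στ , τσ , adj-σ) =
    (λ y → trans (sym (σ≗σ′ (τ y))) (στ y)) ,
    (λ x → trans (cong τ (sym (σ≗σ′ x))) (τσ x)) ,
    (λ u v → trans (cong₂ (adj H) (sym (σ≗σ′ u)) (sym (σ≗σ′ v))) (adj-σ u v))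

  IsIsomorphism-respʳ : ∀ {τ′} → τ ≗ τ′ → IsIsomorphism G H σ τ → IsIsomorphism G H σ τ′
  IsIsomorphism-respʳ τ≗τ′ (στ , τσ , adj-σ) =
    (λ y → trans (cong σ (sym (τ≗τ′ y))) (στ y)) , (λ x → trans (sym (τ≗τ′ (σ x))) (τσ x)) , adj-σ

≅-refl : (G : Graph n) → Isomorphic G G
≅-refl G = isomorphism G G (λ x → x) (λ x → x) ((λ _ → refl) , (λ _ → refl) , (λ _ _ → refl))

≅-sym : ∀ (G : Graph n) (H : Graph m) → Isomorphic G H → Isomorphic H G
≅-sym G H φ = isomorphism H G (from φ) (to φ) (from-to φ , to-from φ , adj-from)
  where
  adj-from : ∀ u v → adj G (from φ u) (from φ v) ≡ adj H u v
  adj-from u v = trans (sym (proj₂ φ (from φ u) (from φ v))) (cong₂ (adj H) (to-from φ u) (to-from φ v))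

≅-trans : ∀ {k} (G : Graph n) (H : Graph m) (K : Graph k) → Isomorphic G H → Isomorphic H K → Isomorphic G K
≅-trans G H K φ ψ = isomorphism G K (to ψ ∘ to φ) (from φ ∘ from ψ)
  ( (λ z → trans (cong (to ψ) (to-from φ (from ψ z))) (to-from ψ z))
  , (λ x → trans (cong (from φ) (from-to ψ (to φ x))) (from-to φ x))
  , (λ u v → trans (proj₂ ψ (to φ u) (to φ v)) (proj₂ φ u v)))

Reach-map : ∀ {G : Graph n} {H : Graph m} (h : Fin n → Fin m) →
  (∀ {u v} → Adj G u v → Adj H (h u) (h v)) → ∀ {x y} → Reach G x y → Reach H (h x) (h y)
Reach-map h hom here         = here
Reach-map h hom (step uw wv) = step (hom uw) (Reach-map h hom wv)

record InducedEmbedding (H : Graph m) (G : Graph n) (ι : Fin m → Fin n) : Set where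
  field
    injective : Injective _≡_ _≡_ ι
    adj-ι     : ∀ u v → adj G (ι u) (ι v) ≡ adj H u v
open InducedEmbedding

module _ {G : Graph n} {G′ : Graph n′} {H : Graph m} {H′ : Graph m′}
         {ι : Fin m → Fin n} {ι′ : Fin m′ → Fin n′}
         (φ : Isomorphic G G′) (emb : InducedEmbedding H G ι) (emb′ : InducedEmbedding H′ G′ ι′)
         (maps : ∀ a → ∃ λ b → to φ (ι a) ≡ ι′ b) (comaps : ∀ b → ∃ λ a → from φ (ι′ b) ≡ ι a) where

  private
    open ≡-Reasoning

    σ : Fin m → Fin m′
    σ = proj₁ ∘ maps

    τ : Fin m′ → Fin m
    τ = proj₁ ∘ comaps

    στ : ∀ b → σ (τ b) ≡ b
    στ b = injective emb′ (begin
      ι′ (σ (τ b))          ≡⟨ sym (proj₂ (maps (τ b))) ⟩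
      to φ (ι (τ b))        ≡⟨ cong (to φ) (sym (proj₂ (comaps b))) ⟩
      to φ (from φ (ι′ b))  ≡⟨ to-from φ (ι′ b) ⟩
      ι′ b                  ∎)

    τσ : ∀ a → τ (σ a) ≡ a
    τσ a = injective emb (begin
      ι (τ (σ a))          ≡⟨ sym (proj₂ (comaps (σ a))) ⟩
      from φ (ι′ (σ a))    ≡⟨ cong (from φ) (sym (proj₂ (maps a))) ⟩
      from φ (to φ (ι a))  ≡⟨ from-to φ (ι a) ⟩
      ι a                  ∎)

    adj-σ : ∀ u v → adj H′ (σ u) (σ v) ≡ adj H u v
    adj-σ u v = begin
      adj H′ (σ u) (σ v)                ≡⟨ sym (adj-ι emb′ (σ u) (σ v)) ⟩
      adj G′ (ι′ (σ u)) (ι′ (σ v))      ≡⟨ cong₂ (adj G′) (sym (proj₂ (maps u))) (sym (proj₂ (maps v))) ⟩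
      adj G′ (to φ (ι u)) (to φ (ι v))  ≡⟨ proj₂ φ (ι u) (ι v) ⟩
      adj G (ι u) (ι v)                 ≡⟨ adj-ι emb u v ⟩
      adj H u v                         ∎

  ≅-restrict : Σ (Isomorphic H H′) λ ψ → ∀ a → to φ (ι a) ≡ ι′ (to ψ a)
  ≅-restrict = isomorphism H H′ σ τ (στ , τσ , adj-σ) , proj₂ ∘ maps

-- Equivalent colorings and their representatives

module _ (G : Graph n) where

  ≗⇒Equivalent : ∀ {f g} → f ≗ g → Equivalent G f g
  ≗⇒Equivalent f≗g = ≅-refl G , f≗g

  Equivalent-sym : ∀ {f g} → Equivalent G f g → Equivalent G g f
  Equivalent-sym {f} (π , fπ≗g) = ≅-sym G G π , λ v → trans (sym (fπ≗g (from π v))) (cong f (to-from π v))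

  Equivalent-trans : ∀ {f g h} → Equivalent G f g → Equivalent G g h → Equivalent G f h
  Equivalent-trans (π , fπ≗g) (ρ , gρ≗h) = ≅-trans G G G ρ π , λ v → trans (fπ≗g (to ρ v)) (gρ≗h v)

  Equivalent-cong : ∀ {f f′ g g′} → f ≗ f′ → g ≗ g′ → Equivalent G f g → Equivalent G f′ g′
  Equivalent-cong f≗f′ g≗g′ (π , fπ≗g) = π , λ v → trans (sym (f≗f′ (to π v))) (trans (fπ≗g v) (g≗g′ v))

  Equivalent? : Decidable (Equivalent G)
  Equivalent? f g = map′ (λ (σ , τ , iso , fσ≗g) → isomorphism G G σ τ iso , fσ≗g)
                         (λ (π , fπ≗g) → to π , from π , (to-from π , from-to π , proj₂ π) , fπ≗g)
                         (∃-map? resp-σ λ σ → ∃-map? (resp-τ σ) (witness? σ))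
    where
    Witness : (Fin n → Fin n) → (Fin n → Fin n) → Set
    Witness σ τ = IsIsomorphism G G σ τ × (f ∘ σ ≗ g)

    witness? : ∀ σ τ → Dec (Witness σ τ)
    witness? σ τ = IsIsomorphism? G G σ τ ×-dec Fin.all? (λ v → f (σ v) ℕ.≟ g v)

    resp-σ : ∀ {σ σ′} → σ ≗ σ′ → ∃ (Witness σ) → ∃ (Witness σ′)
    resp-σ σ≗σ′ (τ , iso , fσ≗g) =
      τ , IsIsomorphism-respˡ {G = G} {G} σ≗σ′ iso , λ v → trans (cong f (sym (σ≗σ′ v))) (fσ≗g v)

    resp-τ : ∀ σ {τ τ′} → τ ≗ τ′ → Witness σ τ → Witness σ τ′
    resp-τ σ τ≗τ′ = map₁ (IsIsomorphism-respʳ {G = G} {G} τ≗τ′)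

  Colorings : DecSetoid 0ℓ 0ℓ
  Colorings = record
    { Carrier = Fin n → ℕ
    ; _≈_ = Equivalent G
    ; isDecEquivalence = record
      { isEquivalence = record
        { refl  = λ {f} → ≗⇒Equivalent {f} (λ _ → refl)
        ; sym   = λ {f} {g} → Equivalent-sym {f} {g}
        ; trans = λ {f} {g} {h} → Equivalent-trans {f} {g} {h}
        }
      ; _≟_ = Equivalent?
      }
    }

  open DecSetoid Colorings using (setoid)

  ProperLColoring? : ∀ L → Decidable₁ (ProperLColoring G L)
  ProperLColoring? L f = Fin.all? (λ v → f v ∈? L v)
    ×-dec Fin.all? (λ u → Fin.all? λ v → (adj G u v Bool.≟ true) →-dec ¬? (f u ℕ.≟ f v))

  ProperLColoring-cong : ∀ {L L′ f f′} → L ≗ L′ → f ≗ f′ → ProperLColoring G L f → ProperLColoring G L′ f′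
  ProperLColoring-cong L≗L′ f≗f′ (f∈L , proper) =
    (λ v → subst₂ _∈_ (f≗f′ v) (L≗L′ v) (f∈L v)) ,
    (λ u v uv fu≡fv → proper u v uv (trans (f≗f′ u) (trans fu≡fv (sym (f≗f′ v)))))

  UnlabeledCount-unique : ∀ {L m m′} → UnlabeledCount G L m → UnlabeledCount G L m′ → m ≡ m′
  UnlabeledCount-unique count count′ = ℕ.≤-antisym (bound count count′) (bound count′ count)
    where
    bound : ∀ {L m m′} → UnlabeledCount G L m → UnlabeledCount G L m′ → m ≤ m′
    bound (reps , refl , proper , reps! , _) (reps′ , refl , _ , _ , complete′) =
      Unique⇒length≤ setoid reps! (All.map (λ {f} → complete′ f) proper)

  UnlabeledCount-cong : ∀ {L L′ m} → L ≗ L′ → UnlabeledCount G L m → UnlabeledCount G L′ m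
  UnlabeledCount-cong L≗L′ (reps , length≡ , proper , reps! , complete) =
    reps , length≡ , All.map (ProperLColoring-cong L≗L′ λ _ → refl) proper , reps! ,
    λ f → complete f ∘ ProperLColoring-cong (sym ∘ L≗L′) (λ _ → refl)

  UnlabeledCount-exists : ∀ L → ∃ (UnlabeledCount G L)
  UnlabeledCount-exists L = length reps , reps , refl , proper , Unique.deduplicate-! Colorings candidates , complete
    where
    candidates reps : List (Fin n → ℕ)
    candidates = filter (ProperLColoring? L) (choiceFunctions L)
    reps = deduplicate Equivalent? candidates

    proper : All (ProperLColoring G L) reps
    proper = All.deduplicate⁺ Equivalent? (All.all-filter (ProperLColoring? L) (choiceFunctions L))

    complete : ∀ f → ProperLColoring G L f → Any (Equivalent G f) reps
    complete f f-proper = SetoidMembershipₚ.∈-deduplicate⁺ setoid Equivalent?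
      (λ {h} {g} {g′} g′≈g h≈g → Equivalent-trans {h} {g} {g′} h≈g (Equivalent-sym {g′} {g} g′≈g)) {z = f}
      (Any.map (λ {g} → ≗⇒Equivalent {f} {g})
        (SetoidMembershipₚ.∈-filter⁺ (Fin n →-setoid ℕ) (ProperLColoring? L) (ProperLColoring-cong (λ _ → refl))
          (choiceFunctions-complete (proj₁ f-proper)) f-proper))

-- Disjoint unions

module DisjointUnion {n₁ n₂} (G₁ : Graph n₁) (G₂ : Graph n₂) where

  data Split : Fin (n₁ + n₂) → Set where
    inl : ∀ a → Split (a ↑ˡ n₂)
    inr : ∀ b → Split (n₁ ↑ʳ b)

  split : ∀ x → Split x
  split x with splitAt n₁ x in eq
  ... | inj₁ a = ≡.subst Split (Fin.splitAt⁻¹-↑ˡ eq) (inl a)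
  ... | inj₂ b = ≡.subst Split (Fin.splitAt⁻¹-↑ʳ eq) (inr b)

  ∀-++ : ∀ {A : Set} {P : A → Set} {f₁ : Fin n₁ → A} {f₂ : Fin n₂ → A} →
    (∀ a → P (f₁ a)) → (∀ b → P (f₂ b)) → ∀ x → P ((f₁ ++ f₂) x)
  ∀-++ p₁ p₂ x with splitAt n₁ x
  ... | inj₁ a = p₁ a
  ... | inj₂ b = p₂ b

  adj-↑ˡ-↑ˡ : ∀ a a′ → adj (G₁ ⊕ G₂) (a ↑ˡ n₂) (a′ ↑ˡ n₂) ≡ adj G₁ a a′
  adj-↑ˡ-↑ˡ a a′ rewrite Fin.splitAt-↑ˡ n₁ a n₂ | Fin.splitAt-↑ˡ n₁ a′ n₂ = refl

  adj-↑ʳ-↑ʳ : ∀ b b′ → adj (G₁ ⊕ G₂) (n₁ ↑ʳ b) (n₁ ↑ʳ b′) ≡ adj G₂ b b′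
  adj-↑ʳ-↑ʳ b b′ rewrite Fin.splitAt-↑ʳ n₁ n₂ b | Fin.splitAt-↑ʳ n₁ n₂ b′ = refl

  adj-↑ˡ-↑ʳ : ∀ a b → adj (G₁ ⊕ G₂) (a ↑ˡ n₂) (n₁ ↑ʳ b) ≡ false
  adj-↑ˡ-↑ʳ a b rewrite Fin.splitAt-↑ˡ n₁ a n₂ | Fin.splitAt-↑ʳ n₁ n₂ b = refl

  adj-↑ʳ-↑ˡ : ∀ b a → adj (G₁ ⊕ G₂) (n₁ ↑ʳ b) (a ↑ˡ n₂) ≡ false
  adj-↑ʳ-↑ˡ b a rewrite Fin.splitAt-↑ʳ n₁ n₂ b | Fin.splitAt-↑ˡ n₁ a n₂ = refl

  ¬Adj-↑ˡ-↑ʳ : ∀ a b → ¬ Adj (G₁ ⊕ G₂) (a ↑ˡ n₂) (n₁ ↑ʳ b)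
  ¬Adj-↑ˡ-↑ʳ a b ab = true≢false (trans (sym ab) (adj-↑ˡ-↑ʳ a b))

  ¬Adj-↑ʳ-↑ˡ : ∀ b a → ¬ Adj (G₁ ⊕ G₂) (n₁ ↑ʳ b) (a ↑ˡ n₂)
  ¬Adj-↑ʳ-↑ˡ b a ba = true≢false (trans (sym ba) (adj-↑ʳ-↑ˡ b a))

  ↑ˡ-induced : InducedEmbedding G₁ (G₁ ⊕ G₂) (_↑ˡ n₂)
  ↑ˡ-induced = record { injective = Fin.↑ˡ-injective n₂ _ _ ; adj-ι = adj-↑ˡ-↑ˡ }

  ↑ʳ-induced : InducedEmbedding G₂ (G₁ ⊕ G₂) (n₁ ↑ʳ_)
  ↑ʳ-induced = record { injective = Fin.↑ʳ-injective n₁ _ _ ; adj-ι = adj-↑ʳ-↑ʳ }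

  Reach-↑ˡ : ∀ {a a′} → Reach G₁ a a′ → Reach (G₁ ⊕ G₂) (a ↑ˡ n₂) (a′ ↑ˡ n₂)
  Reach-↑ˡ = Reach-map (_↑ˡ n₂) λ {u} {v} → trans (adj-↑ˡ-↑ˡ u v)

  Reach-↑ʳ : ∀ {b b′} → Reach G₂ b b′ → Reach (G₁ ⊕ G₂) (n₁ ↑ʳ b) (n₁ ↑ʳ b′)
  Reach-↑ʳ = Reach-map (n₁ ↑ʳ_) λ {u} {v} → trans (adj-↑ʳ-↑ʳ u v)

  onLeft : Fin (n₁ + n₂) → Bool
  onLeft = Vector.replicate n₁ true ++ Vector.replicate n₂ false

  onLeft-↑ˡ : ∀ a → onLeft (a ↑ˡ n₂) ≡ true
  onLeft-↑ˡ = Vector.lookup-++ˡ (Vector.replicate n₁ true) (Vector.replicate n₂ false)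

  onLeft-↑ʳ : ∀ b → onLeft (n₁ ↑ʳ b) ≡ false
  onLeft-↑ʳ = Vector.lookup-++ʳ (Vector.replicate n₁ true) (Vector.replicate n₂ false)

  onLeft≡true : ∀ {x} → onLeft x ≡ true → ∃ λ a → x ≡ a ↑ˡ n₂
  onLeft≡true {x} left with split x
  ... | inl a = a , refl
  ... | inr b = ⊥-elim (true≢false (trans (sym left) (onLeft-↑ʳ b)))

  onLeft≡false : ∀ {x} → onLeft x ≡ false → ∃ λ b → x ≡ n₁ ↑ʳ b
  onLeft≡false {x} right with split x
  ... | inr b = b , refl
  ... | inl a = ⊥-elim (true≢false (trans (sym (onLeft-↑ˡ a)) right))

  Adj-onLeft : ∀ {x y} → Adj (G₁ ⊕ G₂) x y → onLeft x ≡ onLeft y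
  Adj-onLeft {x} {y} xy with split x | split y
  ... | inl a | inl a′ = trans (onLeft-↑ˡ a) (sym (onLeft-↑ˡ a′))
  ... | inr b | inr b′ = trans (onLeft-↑ʳ b) (sym (onLeft-↑ʳ b′))
  ... | inl a | inr b  = ⊥-elim (¬Adj-↑ˡ-↑ʳ a b xy)
  ... | inr b | inl a  = ⊥-elim (¬Adj-↑ʳ-↑ˡ b a xy)

  Reach-onLeft : ∀ {x y} → Reach (G₁ ⊕ G₂) x y → onLeft x ≡ onLeft y
  Reach-onLeft here         = refl
  Reach-onLeft (step xw wy) = trans (Adj-onLeft xw) (Reach-onLeft wy)

  ⊕-map : (Fin n₁ → Fin n₁) → (Fin n₂ → Fin n₂) → Fin (n₁ + n₂) → Fin (n₁ + n₂)
  ⊕-map σ₁ σ₂ = (λ a → σ₁ a ↑ˡ n₂) ++ (λ b → n₁ ↑ʳ σ₂ b)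

  module _ (σ₁ : Fin n₁ → Fin n₁) (σ₂ : Fin n₂ → Fin n₂) where

    ⊕-map-↑ˡ : ∀ a → ⊕-map σ₁ σ₂ (a ↑ˡ n₂) ≡ σ₁ a ↑ˡ n₂
    ⊕-map-↑ˡ = Vector.lookup-++ˡ (λ a → σ₁ a ↑ˡ n₂) (λ b → n₁ ↑ʳ σ₂ b)

    ⊕-map-↑ʳ : ∀ b → ⊕-map σ₁ σ₂ (n₁ ↑ʳ b) ≡ n₁ ↑ʳ σ₂ b
    ⊕-map-↑ʳ = Vector.lookup-++ʳ (λ a → σ₁ a ↑ˡ n₂) (λ b → n₁ ↑ʳ σ₂ b)

  ⊕-map-inverse : ∀ {σ₁ τ₁ σ₂ τ₂} → (∀ a → σ₁ (τ₁ a) ≡ a) → (∀ b → σ₂ (τ₂ b) ≡ b) →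
    ∀ x → ⊕-map σ₁ σ₂ (⊕-map τ₁ τ₂ x) ≡ x
  ⊕-map-inverse {σ₁} {τ₁} {σ₂} {τ₂} στ₁ στ₂ x with split x
  ... | inl a = trans (cong (⊕-map σ₁ σ₂) (⊕-map-↑ˡ τ₁ τ₂ a))
                      (trans (⊕-map-↑ˡ σ₁ σ₂ (τ₁ a)) (cong (_↑ˡ n₂) (στ₁ a)))
  ... | inr b = trans (cong (⊕-map σ₁ σ₂) (⊕-map-↑ʳ τ₁ τ₂ b))
                      (trans (⊕-map-↑ʳ σ₁ σ₂ (τ₂ b)) (cong (n₁ ↑ʳ_) (στ₂ b)))

  ⊕-map-adj : ∀ {σ₁ σ₂} →
    (∀ a a′ → adj G₁ (σ₁ a) (σ₁ a′) ≡ adj G₁ a a′) → (∀ b b′ → adj G₂ (σ₂ b) (σ₂ b′) ≡ adj G₂ b b′) →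
    ∀ u v → adj (G₁ ⊕ G₂) (⊕-map σ₁ σ₂ u) (⊕-map σ₁ σ₂ v) ≡ adj (G₁ ⊕ G₂) u v
  ⊕-map-adj {σ₁} {σ₂} adj-σ₁ adj-σ₂ u v with split u | split v
  ... | inl a | inl a′ = begin
    adj G (σ (a ↑ˡ n₂)) (σ (a′ ↑ˡ n₂))      ≡⟨ cong₂ (adj G) (⊕-map-↑ˡ σ₁ σ₂ a) (⊕-map-↑ˡ σ₁ σ₂ a′) ⟩
    adj G (σ₁ a ↑ˡ n₂) (σ₁ a′ ↑ˡ n₂)        ≡⟨ adj-↑ˡ-↑ˡ (σ₁ a) (σ₁ a′) ⟩
    adj G₁ (σ₁ a) (σ₁ a′)                   ≡⟨ adj-σ₁ a a′ ⟩
    adj G₁ a a′                             ≡⟨ sym (adj-↑ˡ-↑ˡ a a′) ⟩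
    adj G (a ↑ˡ n₂) (a′ ↑ˡ n₂)              ∎
    where open ≡-Reasoning; G = G₁ ⊕ G₂; σ = ⊕-map σ₁ σ₂
  ... | inr b | inr b′ = begin
    adj G (σ (n₁ ↑ʳ b)) (σ (n₁ ↑ʳ b′))      ≡⟨ cong₂ (adj G) (⊕-map-↑ʳ σ₁ σ₂ b) (⊕-map-↑ʳ σ₁ σ₂ b′) ⟩
    adj G (n₁ ↑ʳ σ₂ b) (n₁ ↑ʳ σ₂ b′)        ≡⟨ adj-↑ʳ-↑ʳ (σ₂ b) (σ₂ b′) ⟩
    adj G₂ (σ₂ b) (σ₂ b′)                   ≡⟨ adj-σ₂ b b′ ⟩
    adj G₂ b b′                             ≡⟨ sym (adj-↑ʳ-↑ʳ b b′) ⟩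
    adj G (n₁ ↑ʳ b) (n₁ ↑ʳ b′)              ∎
    where open ≡-Reasoning; G = G₁ ⊕ G₂; σ = ⊕-map σ₁ σ₂
  ... | inl a | inr b = trans (cong₂ (adj (G₁ ⊕ G₂)) (⊕-map-↑ˡ σ₁ σ₂ a) (⊕-map-↑ʳ σ₁ σ₂ b))
                              (trans (adj-↑ˡ-↑ʳ (σ₁ a) (σ₂ b)) (sym (adj-↑ˡ-↑ʳ a b)))
  ... | inr b | inl a = trans (cong₂ (adj (G₁ ⊕ G₂)) (⊕-map-↑ʳ σ₁ σ₂ b) (⊕-map-↑ˡ σ₁ σ₂ a))
                              (trans (adj-↑ʳ-↑ˡ (σ₂ b) (σ₁ a)) (sym (adj-↑ʳ-↑ˡ b a)))

  _⊕ᵃ_ : Aut G₁ → Aut G₂ → Aut (G₁ ⊕ G₂)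
  π₁ ⊕ᵃ π₂ = isomorphism (G₁ ⊕ G₂) (G₁ ⊕ G₂) (⊕-map (to π₁) (to π₂)) (⊕-map (from π₁) (from π₂))
    ( ⊕-map-inverse (to-from π₁) (to-from π₂)
    , ⊕-map-inverse (from-to π₁) (from-to π₂)
    , ⊕-map-adj (proj₂ π₁) (proj₂ π₂))

  Equivalent-++ : ∀ {f g₁ g₂} → Equivalent G₁ (f ∘ (_↑ˡ n₂)) g₁ → Equivalent G₂ (f ∘ (n₁ ↑ʳ_)) g₂ →
    Equivalent (G₁ ⊕ G₂) f (g₁ ++ g₂)
  Equivalent-++ {f} {g₁} {g₂} (π₁ , fπ₁≗g₁) (π₂ , fπ₂≗g₂) = π₁ ⊕ᵃ π₂ , fπ≗g
    where
    fπ≗g : ∀ x → f (⊕-map (to π₁) (to π₂) x) ≡ (g₁ ++ g₂) x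
    fπ≗g x with split x
    ... | inl a = trans (cong f (⊕-map-↑ˡ _ _ a)) (trans (fπ₁≗g₁ a) (sym (Vector.lookup-++ˡ g₁ g₂ a)))
    ... | inr b = trans (cong f (⊕-map-↑ʳ _ _ b)) (trans (fπ₂≗g₂ b) (sym (Vector.lookup-++ʳ g₁ g₂ b)))

  module _ {L : Fin (n₁ + n₂) → List ℕ} {f : Fin (n₁ + n₂) → ℕ} where

    ProperLColoring-↑ˡ : ProperLColoring (G₁ ⊕ G₂) L f → ProperLColoring G₁ (L ∘ (_↑ˡ n₂)) (f ∘ (_↑ˡ n₂))
    ProperLColoring-↑ˡ (f∈L , proper) = f∈L ∘ (_↑ˡ n₂) , λ a a′ aa′ → proper _ _ (trans (adj-↑ˡ-↑ˡ a a′) aa′)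

    ProperLColoring-↑ʳ : ProperLColoring (G₁ ⊕ G₂) L f → ProperLColoring G₂ (L ∘ (n₁ ↑ʳ_)) (f ∘ (n₁ ↑ʳ_))
    ProperLColoring-↑ʳ (f∈L , proper) = f∈L ∘ (n₁ ↑ʳ_) , λ b b′ bb′ → proper _ _ (trans (adj-↑ʳ-↑ʳ b b′) bb′)

    ProperLColoring-join : ProperLColoring G₁ (L ∘ (_↑ˡ n₂)) (f ∘ (_↑ˡ n₂)) →
      ProperLColoring G₂ (L ∘ (n₁ ↑ʳ_)) (f ∘ (n₁ ↑ʳ_)) → ProperLColoring (G₁ ⊕ G₂) L f
    ProperLColoring-join (f∈L₁ , proper₁) (f∈L₂ , proper₂) = f∈L , proper
      where
      f∈L : ∀ x → f x ∈ L x
      f∈L x with split x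
      ... | inl a = f∈L₁ a
      ... | inr b = f∈L₂ b
      proper : ∀ u v → Adj (G₁ ⊕ G₂) u v → f u ≢ f v
      proper u v uv with split u | split v
      ... | inl a | inl a′ = proper₁ a a′ (trans (sym (adj-↑ˡ-↑ˡ a a′)) uv)
      ... | inr b | inr b′ = proper₂ b b′ (trans (sym (adj-↑ʳ-↑ʳ b b′)) uv)
      ... | inl a | inr b  = ⊥-elim (¬Adj-↑ˡ-↑ʳ a b uv)
      ... | inr b | inl a  = ⊥-elim (¬Adj-↑ʳ-↑ˡ b a uv)

  KAssignment-++ : ∀ {L₁ L₂} → KAssignment G₁ k L₁ → KAssignment G₂ k L₂ →
    KAssignment (G₁ ⊕ G₂) k (L₁ ++ L₂)
  KAssignment-++ {k} = ∀-++ {P = λ l → Unique≡ l × length l ≡ k}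

  module NonIsomorphicComponents (conn₁ : Connected G₁) (conn₂ : Connected G₂) (G₁≇G₂ : ¬ Isomorphic G₁ G₂) where

    private
      v₁ : Fin n₁
      v₁ = fromℕ< (proj₁ conn₁)
      v₂ : Fin n₂
      v₂ = fromℕ< (proj₁ conn₂)

    module _ (π : Aut (G₁ ⊕ G₂)) where

      sˡ sʳ : Bool
      sˡ = onLeft (to π (v₁ ↑ˡ n₂))
      sʳ = onLeft (to π (n₁ ↑ʳ v₂))

      Reach-to : ∀ {x y} → Reach (G₁ ⊕ G₂) x y → Reach (G₁ ⊕ G₂) (to π x) (to π y)
      Reach-to = Reach-map (to π) λ {u} {v} → trans (proj₂ π u v)

      onLeft-to-↑ˡ : ∀ a → onLeft (to π (a ↑ˡ n₂)) ≡ sˡ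
      onLeft-to-↑ˡ a = sym (Reach-onLeft (Reach-to (Reach-↑ˡ (proj₂ conn₁ v₁ a))))

      onLeft-to-↑ʳ : ∀ b → onLeft (to π (n₁ ↑ʳ b)) ≡ sʳ
      onLeft-to-↑ʳ b = sym (Reach-onLeft (Reach-to (Reach-↑ʳ (proj₂ conn₂ v₂ b))))

      -- π is onto, so its image meets both sides.
      sˡ≢sʳ : sˡ ≢ sʳ
      sˡ≢sʳ sˡ≡sʳ = true≢false (begin
        true                               ≡⟨ sym (onLeft-↑ˡ v₁) ⟩
        onLeft (v₁ ↑ˡ n₂)                  ≡⟨ cong onLeft (sym (to-from π _)) ⟩
        onLeft (to π (from π (v₁ ↑ˡ n₂)))  ≡⟨ onLeft-to-const _ ⟩
        sˡ                                 ≡⟨ sym (onLeft-to-const _) ⟩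
        onLeft (to π (from π (n₁ ↑ʳ v₂)))  ≡⟨ cong onLeft (to-from π _) ⟩
        onLeft (n₁ ↑ʳ v₂)                  ≡⟨ onLeft-↑ʳ v₂ ⟩
        false                              ∎)
        where
        open ≡-Reasoning
        onLeft-to-const : ∀ x → onLeft (to π x) ≡ sˡ
        onLeft-to-const x with split x
        ... | inl a = onLeft-to-↑ˡ a
        ... | inr b = trans (onLeft-to-↑ʳ b) (sym sˡ≡sʳ)

      preimage-↑ˡ : ∀ {x} → onLeft (to π x) ≡ sˡ → ∃ λ a → x ≡ a ↑ˡ n₂
      preimage-↑ˡ {x} e with split x
      ... | inl a = a , refl
      ... | inr b = ⊥-elim (sˡ≢sʳ (trans (sym e) (onLeft-to-↑ʳ b)))

      preimage-↑ʳ : ∀ {x} → onLeft (to π x) ≡ sʳ → ∃ λ b → x ≡ n₁ ↑ʳ b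
      preimage-↑ʳ {x} e with split x
      ... | inr b = b , refl
      ... | inl a = ⊥-elim (sˡ≢sʳ (trans (sym (onLeft-to-↑ˡ a)) e))

      -- Otherwise π would restrict to an isomorphism from G₁ onto G₂.
      sˡ≡true : sˡ ≡ true
      sˡ≡true with sˡ in sˡ≡
      ... | true  = refl
      ... | false = ⊥-elim (G₁≇G₂ (proj₁ (≅-restrict π ↑ˡ-induced ↑ʳ-induced maps comaps)))
        where
        maps : ∀ a → ∃ λ b → to π (a ↑ˡ n₂) ≡ n₁ ↑ʳ b
        maps a = onLeft≡false (trans (onLeft-to-↑ˡ a) sˡ≡)
        comaps : ∀ b → ∃ λ a → from π (n₁ ↑ʳ b) ≡ a ↑ˡ n₂
        comaps b = preimage-↑ˡ (trans (cong onLeft (to-from π _)) (trans (onLeft-↑ʳ b) (sym sˡ≡)))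

      sʳ≡false : sʳ ≡ false
      sʳ≡false = trans (Bool.¬-not (sˡ≢sʳ ∘ sym)) (cong not sˡ≡true)

      restrictˡ : Σ (Aut G₁) λ ψ → ∀ a → to π (a ↑ˡ n₂) ≡ to ψ a ↑ˡ n₂
      restrictˡ = ≅-restrict π ↑ˡ-induced ↑ˡ-induced
        (λ a → onLeft≡true (trans (onLeft-to-↑ˡ a) sˡ≡true))
        (λ a → preimage-↑ˡ (trans (cong onLeft (to-from π _)) (trans (onLeft-↑ˡ a) (sym sˡ≡true))))

      restrictʳ : Σ (Aut G₂) λ ψ → ∀ b → to π (n₁ ↑ʳ b) ≡ n₁ ↑ʳ to ψ b
      restrictʳ = ≅-restrict π ↑ʳ-induced ↑ʳ-induced
        (λ b → onLeft≡false (trans (onLeft-to-↑ʳ b) sʳ≡false))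
        (λ b → preimage-↑ʳ (trans (cong onLeft (to-from π _)) (trans (onLeft-↑ʳ b) (sym sʳ≡false))))

    Equivalent-↑ˡ : ∀ {f g} → Equivalent (G₁ ⊕ G₂) f g → Equivalent G₁ (f ∘ (_↑ˡ n₂)) (g ∘ (_↑ˡ n₂))
    Equivalent-↑ˡ {f} (π , fπ≗g) with restrictˡ π
    ... | ψ , π≡ψ = ψ , λ a → trans (cong f (sym (π≡ψ a))) (fπ≗g (a ↑ˡ n₂))

    Equivalent-↑ʳ : ∀ {f g} → Equivalent (G₁ ⊕ G₂) f g → Equivalent G₂ (f ∘ (n₁ ↑ʳ_)) (g ∘ (n₁ ↑ʳ_))
    Equivalent-↑ʳ {f} (π , fπ≗g) with restrictʳ π
    ... | ψ , π≡ψ = ψ , λ b → trans (cong f (sym (π≡ψ b))) (fπ≗g (n₁ ↑ʳ b))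

    UnlabeledCount-⊕ : ∀ {L c₁ c₂} → UnlabeledCount G₁ (L ∘ (_↑ˡ n₂)) c₁ →
      UnlabeledCount G₂ (L ∘ (n₁ ↑ʳ_)) c₂ → UnlabeledCount (G₁ ⊕ G₂) L (c₁ * c₂)
    UnlabeledCount-⊕ {L} (reps₁ , refl , proper₁ , reps₁! , complete₁) (reps₂ , refl , proper₂ , reps₂! , complete₂) =
      reps , length-cartesianProductWith _++_ reps₁ reps₂ , proper , reps! , complete
      where
      reps : List (Fin (n₁ + n₂) → ℕ)
      reps = cartesianProductWith _++_ reps₁ reps₂

      proper : All (ProperLColoring (G₁ ⊕ G₂) L) reps
      proper = All.cartesianProductWith⁺ (≡.setoid _) (≡.setoid _) _++_ reps₁ reps₂ λ {g₁} {g₂} g₁∈ g₂∈ →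
        ProperLColoring-join
          (ProperLColoring-cong G₁ (λ _ → refl) (sym ∘ Vector.lookup-++ˡ g₁ g₂) (All.lookup proper₁ g₁∈))
          (ProperLColoring-cong G₂ (λ _ → refl) (sym ∘ Vector.lookup-++ʳ g₁ g₂) (All.lookup proper₂ g₂∈))

      separate : ∀ {g₁ h₁ g₂ h₂} → Equivalent (G₁ ⊕ G₂) (g₁ ++ g₂) (h₁ ++ h₂) →
        Equivalent G₁ g₁ h₁ × Equivalent G₂ g₂ h₂
      separate {g₁} {h₁} {g₂} {h₂} g≈h =
        Equivalent-cong G₁ (Vector.lookup-++ˡ g₁ g₂) (Vector.lookup-++ˡ h₁ h₂)
          (Equivalent-↑ˡ {g₁ ++ g₂} {h₁ ++ h₂} g≈h) ,
        Equivalent-cong G₂ (Vector.lookup-++ʳ g₁ g₂) (Vector.lookup-++ʳ h₁ h₂)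
          (Equivalent-↑ʳ {g₁ ++ g₂} {h₁ ++ h₂} g≈h)

      reps! : Unique (DecSetoid.setoid (Colorings (G₁ ⊕ G₂))) reps
      reps! = Unique.cartesianProductWith⁺ (DecSetoid.setoid (Colorings G₁)) (DecSetoid.setoid (Colorings G₂))
        (DecSetoid.setoid (Colorings (G₁ ⊕ G₂))) _++_ separate reps₁! reps₂!

      complete : ∀ f → ProperLColoring (G₁ ⊕ G₂) L f → Any (Equivalent (G₁ ⊕ G₂) f) reps
      complete f f-proper = Any.cartesianProductWith⁺ _++_ (λ {g₁} {g₂} → Equivalent-++ {f} {g₁} {g₂})
        (complete₁ _ (ProperLColoring-↑ˡ f-proper)) (complete₂ _ (ProperLColoring-↑ʳ f-proper))

proposition1p6 : ∀ {n₁ n₂} (G₁ : Graph n₁) (G₂ : Graph n₂) →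
    Connected G₁ → Connected G₂ → ¬ Isomorphic G₁ G₂ →
    ∀ (k m₁ m₂ : ℕ) →
    UnlabeledListColorFn G₁ k m₁ → UnlabeledListColorFn G₂ k m₂ →
    UnlabeledListColorFn (G₁ ⊕ G₂) k (m₁ * m₂)
proposition1p6 {n₁} {n₂} G₁ G₂ conn₁ conn₂ G₁≇G₂ k m₁ m₂
  ((L₁ , L₁-k , count₁) , min₁) ((L₂ , L₂-k , count₂) , min₂) =
  (L₁ ++ L₂ , KAssignment-++ L₁-k L₂-k , UnlabeledCount-⊕ count₁′ count₂′) , minimal
  where
  open DisjointUnion G₁ G₂
  open NonIsomorphicComponents conn₁ conn₂ G₁≇G₂

  count₁′ : UnlabeledCount G₁ ((L₁ ++ L₂) ∘ (_↑ˡ n₂)) m₁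
  count₁′ = UnlabeledCount-cong G₁ (sym ∘ Vector.lookup-++ˡ L₁ L₂) count₁

  count₂′ : UnlabeledCount G₂ ((L₁ ++ L₂) ∘ (n₁ ↑ʳ_)) m₂
  count₂′ = UnlabeledCount-cong G₂ (sym ∘ Vector.lookup-++ʳ L₁ L₂) count₂

  minimal : ∀ L m → KAssignment (G₁ ⊕ G₂) k L → UnlabeledCount (G₁ ⊕ G₂) L m → m₁ * m₂ ≤ m
  minimal L m L-k count with UnlabeledCount-exists G₁ (L ∘ (_↑ˡ n₂)) | UnlabeledCount-exists G₂ (L ∘ (n₁ ↑ʳ_))
  ... | c₁ , L₁-count | c₂ , L₂-count = begin
    m₁ * m₂  ≤⟨ ℕ.*-mono-≤ (min₁ _ c₁ (L-k ∘ (_↑ˡ n₂)) L₁-count)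
                           (min₂ _ c₂ (L-k ∘ (n₁ ↑ʳ_)) L₂-count) ⟩
    c₁ * c₂  ≡⟨ UnlabeledCount-unique (G₁ ⊕ G₂) (UnlabeledCount-⊕ L₁-count L₂-count) count ⟩
    m        ∎
    where open ℕ.≤-Reasoning
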